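{- For all sets $X$ and all codes $a,b\in\mathscr{A}^X$: $[\![a]\!]^{\mathscr{A}}_X\le[\![b]\!]^{\mathscr{A}}_X$ iff $\bigwedge_{x\in X}(a_x\to b_x)\in S$, where $\bigwedge$ is the meet in $(\mathscr{A},\preccurlyeq)$.
   Context: Let $\mathsf{P}:\mathbf{Set}^{\mathrm{op}}\to\mathbf{HA}$ be a $\mathbf{Set}$-based tripos (adjoints $\exists f\dashv\mathsf{P}f\dashv\forall f$ for each map $f$, Beck–Chevalley for all pullbacks in $\mathbf{Set}$) with a fixed generic predicate $\mathrm{tr}_\Sigma\in\mathsf{P}\Sigma$; for $\sigma\in\Sigma^X$ write $[\![\sigma]\!]_X=\mathsf{P}\sigma(\mathrm{tr}_\Sigma)$ (surjective onto $\mathsf{P}X$). Pick $\dot\to:\Sigma\times\Sigma\to\Sigma$ with $[\![\dot\to]\!]_{\Sigma\times\Sigma}=[\![\pi]\!]\to[\![\pi']\!]$ ($\pi,\pi'$ the projections), and, with $E=\{(\xi,s):\xi\in s\}\subseteq\Sigma\times\mathfrak{P}(\Sigma)$ and projections $e_1,e_2$, pick $\dot\bigwedge:\mathfrak{P}(\Sigma)\to\Sigma$ with $[\![\dot\bigwedge]\!]_{\mathfrak{P}(\Sigma)}=\forall e_2([\![e_1]\!]_E)$. Atoms $\mathscr{A}_0$: inductively $\dot\xi$ ($\xi\in\Sigma$) and $s\mapsto\alpha$ ($s\subseteq\Sigma$, $\alpha\in\mathscr{A}_0$), preordered by $\dot\xi\le\dot\xi$ and $s\mapsto\alpha\le s'\mapsto\alpha'$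 if $s\subseteq s'$, $\alpha\le\alpha'$; $\phi_0(\dot\xi)=\xi$, $\phi_0(s\mapsto\alpha)=(\dot\bigwedge s)\mathbin{\dot\to}\phi_0(\alpha)$. $\mathscr{A}$ is the set of upwards closed subsets of $\mathscr{A}_0$ with $a\preccurlyeq b$ iff $a\supseteq b$, so meets are unions. Let $\tilde\phi_0(a)=\{\phi_0(\alpha):\alpha\in a\}$, $a\to b=\{s\mapsto\beta: s\in\mathfrak{P}(\Sigma),\ \tilde\phi_0(a)\subseteq s,\ \beta\in b\}$, $\phi(a)=\dot\bigwedge\tilde\phi_0(a)$, $\mathrm{tr}_{\mathscr{A}}=\mathsf{P}\phi(\mathrm{tr}_\Sigma)\in\mathsf{P}\mathscr{A}$, and for $a\in\mathscr{A}^X$ write $[\![a]\!]^{\mathscr{A}}_X=[\![a_x]\!]^{\mathscr{A}}_{x\in X}=\mathsf{P}a(\mathrm{tr}_{\mathscr{A}})$. Finally $S=\{a\in\mathscr{A}:[\![a]\!]^{\mathscr{A}}_{\_\in1}=\top_1\}$, where $1$ is a singleton and $\top_1$ the top of $\mathsf{P}1$ (a separator of $(\mathscr{A},\preccurlyeq,\to)$). -}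

module Defs where

open import Level using (Level; _⊔_; Lift; lift; Setω) renaming (suc to lsuc)
open import Function using (id; _∘_; _⇔_)
open import Data.Product using (Σ; _×_; _,_; proj₁; proj₂)
open import Data.Empty using () renaming (⊥ to 𝟘)
open import Data.Unit using () renaming (⊤ to 𝟙)
open import Relation.Binary.PropositionalEquality using (_≡_)
open import Relation.Binary.Lattice.Bundles using (HeytingAlgebra)

open HeytingAlgebra using (Carrier)

module _ {c ℓ₁ ℓ₂ : Level} (H : HeytingAlgebra c ℓ₁ ℓ₂) where
  open HeytingAlgebra H hiding (Carrier)
  ≈[_] : Carrier H → Carrier H → Set ℓ₁
  ≈[_] = _≈_
  ≤[_] : Carrier H → Carrier H → Set ℓ₂
  ≤[_] = _≤_
  ∧[_] ∨[_] ⇨[_] : Carrier H → Carrier H → Carrier H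
  ∧[_] = _∧_
  ∨[_] = _∨_
  ⇨[_] = _⇨_
  ⊤[_] ⊥[_] : Carrier H
  ⊤[_] = ⊤
  ⊥[_] = ⊥

--        g'
--   X' -----> X
--   |         |
-- f'|         | f
--   v         v
--   Y' -----> Y
--        g

record IsPullback {a b c d : Level} {X' : Set a} {X : Set b} {Y' : Set c} {Y : Set d}
                  (g' : X' → X) (f' : X' → Y') (f : X → Y) (g : Y' → Y) : Setω where
  field
    commutes  : ∀ x' → f (g' x') ≡ g (f' x')
    universal : ∀ {l} {Z : Set l} (h : Z → X) (k : Z → Y') →
                (∀ z → f (h z) ≡ g (k z)) →
                Σ (Z → X') λ u → (∀ z → g' (u z) ≡ h z) × (∀ z → f' (u z) ≡ k z)
    unique    : ∀ {l} {Z : Set l} (u v : Z → X') →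
                (∀ z → g' (u z) ≡ g' (v z)) → (∀ z → f' (u z) ≡ f' (v z)) →
                ∀ z → u z ≡ v z

-- A Set-based tripos: a functor P : Set^op → HA (P f a Heyting algebra
-- homomorphism), with adjoints ∃f ⊣ P f ⊣ ∀f and Beck–Chevalley for all
-- pullback squares in Set.  "Set" is the whole (level-polymorphic) Agda
-- hierarchy of types; P X for X : Set i has levels shifted by i.

record Tripos (c ℓ₁ ℓ₂ : Level) : Setω where
  field
    P : ∀ {i} → Set i → HeytingAlgebra (c ⊔ i) (ℓ₁ ⊔ i) (ℓ₂ ⊔ i)

  field
    Pf : ∀ {i j} {X : Set i} {Y : Set j} → (X → Y) → Carrier (P Y) → Carrier (P X)
    Pf-cong : ∀ {i j} {X : Set i} {Y : Set j} (f : X → Y) {φ ψ} →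
              ≈[ P Y ] φ ψ → ≈[ P X ] (Pf f φ) (Pf f ψ)
    Pf-⊤ : ∀ {i j} {X : Set i} {Y : Set j} (f : X → Y) → ≈[ P X ] (Pf f ⊤[ P Y ]) ⊤[ P X ]
    Pf-⊥ : ∀ {i j} {X : Set i} {Y : Set j} (f : X → Y) → ≈[ P X ] (Pf f ⊥[ P Y ]) ⊥[ P X ]
    Pf-∧ : ∀ {i j} {X : Set i} {Y : Set j} (f : X → Y) φ ψ →
           ≈[ P X ] (Pf f (∧[ P Y ] φ ψ)) (∧[ P X ] (Pf f φ) (Pf f ψ))
    Pf-∨ : ∀ {i j} {X : Set i} {Y : Set j} (f : X → Y) φ ψ →
           ≈[ P X ] (Pf f (∨[ P Y ] φ ψ)) (∨[ P X ] (Pf f φ) (Pf f ψ))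
    Pf-⇨ : ∀ {i j} {X : Set i} {Y : Set j} (f : X → Y) φ ψ →
           ≈[ P X ] (Pf f (⇨[ P Y ] φ ψ)) (⇨[ P X ] (Pf f φ) (Pf f ψ))
    Pf-id : ∀ {i} {X : Set i} φ → ≈[ P X ] (Pf id φ) φ
    Pf-∘  : ∀ {i j k} {X : Set i} {Y : Set j} {Z : Set k} (f : X → Y) (g : Y → Z) φ →
            ≈[ P X ] (Pf (g ∘ f) φ) (Pf f (Pf g φ))
    -- maps of sets are equal when pointwise equal
    Pf-ext : ∀ {i j} {X : Set i} {Y : Set j} (f g : X → Y) → (∀ x → f x ≡ g x) →
             ∀ φ → ≈[ P X ] (Pf f φ) (Pf g φ)
    Ex  : ∀ {i j} {X : Set i} {Y : Set j} → (X → Y) → Carrier (P X) → Carrier (P Y)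
    All : ∀ {i j} {X : Set i} {Y : Set j} → (X → Y) → Carrier (P X) → Carrier (P Y)
    Ex⊣Pf : ∀ {i j} {X : Set i} {Y : Set j} (f : X → Y) φ ψ →
            ≤[ P Y ] (Ex f φ) ψ ⇔ ≤[ P X ] φ (Pf f ψ)
    Pf⊣All : ∀ {i j} {X : Set i} {Y : Set j} (f : X → Y) ψ φ →
             ≤[ P X ] (Pf f ψ) φ ⇔ ≤[ P Y ] ψ (All f φ)
    BC-Ex  : ∀ {a b c' d} {X' : Set a} {X : Set b} {Y' : Set c'} {Y : Set d}
               {g' : X' → X} {f' : X' → Y'} {f : X → Y} {g : Y' → Y} →
             IsPullback g' f' f g →
             ∀ φ → ≈[ P Y' ] (Pf g (Ex f φ)) (Ex f' (Pf g' φ))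
    BC-All : ∀ {a b c' d} {X' : Set a} {X : Set b} {Y' : Set c'} {Y : Set d}
               {g' : X' → X} {f' : X' → Y'} {f : X → Y} {g : Y' → Y} →
             IsPullback g' f' f g →
             ∀ φ → ≈[ P Y' ] (Pf g (All f φ)) (All f' (Pf g' φ))

-- The data fixed in the context: a tripos, a generic predicate tr_Σ,
-- the power set 𝔓(Σ), the codes →̇ and ⋀̇.

record Setting (c ℓ₁ ℓ₂ ℓ : Level) : Setω where
  field
    tripos : Tripos c ℓ₁ ℓ₂
  open Tripos tripos public

  field
    Σ̇   : Set ℓ
    trΣ : Carrier (P Σ̇)
    generic : ∀ {i} {X : Set i} (φ : Carrier (P X)) →
              Σ (X → Σ̇) λ σ → ≈[ P X ] (Pf σ trΣ) φ

    𝔓Σ     : Set ℓ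
    _∈̇_    : Σ̇ → 𝔓Σ → Set ℓ
    ∈-prop : ∀ {ξ s} (p q : ξ ∈̇ s) → p ≡ q
    ext    : ∀ s t → (∀ ξ → (ξ ∈̇ s) ⇔ (ξ ∈̇ t)) → s ≡ t
    ｛_｝   : ∀ {l} → (Σ̇ → Set l) → 𝔓Σ
    ｛｝-spec : ∀ {l} (Q : Σ̇ → Set l) ξ → (ξ ∈̇ ｛ Q ｝) ⇔ Q ξ

  ⟦_⟧Σ : ∀ {i} {X : Set i} → (X → Σ̇) → Carrier (P X)
  ⟦ σ ⟧Σ = Pf σ trΣ

  E : Set ℓ
  E = Σ (Σ̇ × 𝔓Σ) λ p → proj₁ p ∈̇ proj₂ p

  e₁ : E → Σ̇
  e₁ = proj₁ ∘ proj₁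

  e₂ : E → 𝔓Σ
  e₂ = proj₂ ∘ proj₁

  field
    arrow      : Σ̇ × Σ̇ → Σ̇
    arrow-spec : ≈[ P (Σ̇ × Σ̇) ] ⟦ arrow ⟧Σ (⇨[ P (Σ̇ × Σ̇) ] ⟦ proj₁ ⟧Σ ⟦ proj₂ ⟧Σ)
    meet       : 𝔓Σ → Σ̇
    meet-spec  : ≈[ P 𝔓Σ ] ⟦ meet ⟧Σ (All e₂ ⟦ e₁ ⟧Σ)

module Construction {c ℓ₁ ℓ₂ ℓ : Level} (𝒮 : Setting c ℓ₁ ℓ₂ ℓ) where
  open Setting 𝒮 public

  _⊆̇_ : 𝔓Σ → 𝔓Σ → Set ℓ
  s ⊆̇ t = ∀ ξ → ξ ∈̇ s → ξ ∈̇ t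

  infixr 5 _↦_
  data 𝒜₀ : Set ℓ where
    dot : Σ̇ → 𝒜₀
    _↦_ : 𝔓Σ → 𝒜₀ → 𝒜₀

  data _≤₀_ : 𝒜₀ → 𝒜₀ → Set ℓ where
    dot≤ : ∀ {ξ} → dot ξ ≤₀ dot ξ
    ↦≤   : ∀ {s s' α α'} → s ⊆̇ s' → α ≤₀ α' → (s ↦ α) ≤₀ (s' ↦ α')

  φ₀ : 𝒜₀ → Σ̇
  φ₀ (dot ξ) = ξ
  φ₀ (s ↦ α) = arrow (meet s , φ₀ α)

  record 𝒜 : Set (lsuc ℓ) where
    field
      mem : 𝒜₀ → Set ℓ
      up  : ∀ {α β} → mem α → α ≤₀ β → mem β
  open 𝒜 public

  _≼_ : 𝒜 → 𝒜 → Set ℓ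
  a ≼ b = ∀ α → mem b α → mem a α

  -- meets in (𝒜, ≼) are unions
  ⋀ : {X : Set ℓ} → (X → 𝒜) → 𝒜
  ⋀ {X} c = record { mem = λ α → Σ X λ x → mem (c x) α
                   ; up  = λ { (x , m) le → x , up (c x) m le } }

  _φ̃₀⊆_ : 𝒜 → 𝔓Σ → Set ℓ
  a φ̃₀⊆ s = ∀ α → mem a α → φ₀ α ∈̇ s

  ⇒mem : 𝒜 → 𝒜 → 𝒜₀ → Set ℓ
  ⇒mem a b (dot ξ) = Lift ℓ 𝟘
  ⇒mem a b (s ↦ β) = (a φ̃₀⊆ s) × mem b β

  ⇒up : ∀ a b {α β} → ⇒mem a b α → α ≤₀ β → ⇒mem a b β
  ⇒up a b (h , m) (↦≤ s⊆s' le) = (λ α mα → s⊆s' _ (h α mα)) , up b m le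

  infixr 5 _⇒_
  _⇒_ : 𝒜 → 𝒜 → 𝒜
  a ⇒ b = record { mem = ⇒mem a b ; up = ⇒up a b }

  φ̃₀ : 𝒜 → 𝔓Σ
  φ̃₀ a = ｛ (λ ξ → Σ 𝒜₀ λ α → mem a α × (φ₀ α ≡ ξ)) ｝

  φ : 𝒜 → Σ̇
  φ a = meet (φ̃₀ a)

  tr𝒜 : Carrier (P 𝒜)
  tr𝒜 = Pf φ trΣ

  ⟦_⟧𝒜 : ∀ {i} {X : Set i} → (X → 𝒜) → Carrier (P X)
  ⟦ a ⟧𝒜 = Pf a tr𝒜

  _∈S : 𝒜 → Set (ℓ₁)
  a ∈S = ≈[ P 𝟙 ] ⟦ (λ (_ : 𝟙) → a) ⟧𝒜 ⊤[ P 𝟙 ]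

-- Since ⟦b x⟧ is the meet of the φ₀ β for the atoms β ∈ b x, ⟦a⟧ ≤ ⟦b⟧ says that
-- φ(a x) ≤ φ₀ β for every atom β of every b x.  The atoms of ⋀ₓ (a x ⇒ b x) are the
-- s ↦ β with φ̃₀(a x) ⊆ s and β ∈ b x, and membership in S says that each
-- φ₀(s ↦ β) = (⋀̇ s) →̇ φ₀ β is true, i.e. that ⋀̇ s ≤ φ₀ β.  As ⋀̇ is antitone, the
-- instance s = φ̃₀(a x) is the strongest of these, and it is exactly the first condition.

module Submission where

open import Defs
open import Level using (Level; _⊔_; lift) renaming (suc to lsuc)
open import Function using (_⇔_; _∘_; mk⇔; Equivalence)
import Function.Properties.Equivalence as ⇔
open import Function.Related.Propositional using (equivalence; module EquationalReasoning)
open import Data.Product using (Σ; _×_; _,_; proj₁; proj₂)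
open import Data.Unit using (tt) renaming (⊤ to 𝟙)
open import Data.Empty using (⊥-elim)
open import Relation.Nullary using (¬_)
open import Relation.Binary.PropositionalEquality using (_≡_; _≗_; refl; cong; subst)
open import Relation.Binary.Lattice.Bundles using (HeytingAlgebra)

open Equivalence using (to; from)

module HeytingAlgebraFacts {c ℓ₁ ℓ₂ : Level} (H : HeytingAlgebra c ℓ₁ ℓ₂) where
  open HeytingAlgebra H using (_≈_; _≤_; _⇨_; ⊤; module Eq; ≤-respˡ-≈; ≤-respʳ-≈;
    reflexive; antisym; trans; maximum; ∧-greatest; x∧y≤y; transpose-∧; transpose-⇨)
    renaming (refl to ≤-refl)

  ≤-resp-≈⇔ : ∀ {x x' y y'} → x ≈ x' → y ≈ y' → (x ≤ y) ⇔ (x' ≤ y')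
  ≤-resp-≈⇔ x≈x' y≈y' =
    mk⇔ (≤-respˡ-≈ x≈x' ∘ ≤-respʳ-≈ y≈y')
        (≤-respˡ-≈ (Eq.sym x≈x') ∘ ≤-respʳ-≈ (Eq.sym y≈y'))

  ≈⊤⇔⊤≤ : ∀ {x} → (x ≈ ⊤) ⇔ (⊤ ≤ x)
  ≈⊤⇔⊤≤ = mk⇔ (reflexive ∘ Eq.sym) (antisym (maximum _))

  ⊤≤⇨⇔≤ : ∀ {x y} → (⊤ ≤ x ⇨ y) ⇔ (x ≤ y)
  ⊤≤⇨⇔≤ = mk⇔ (λ h → trans (∧-greatest (maximum _) ≤-refl) (transpose-∧ h))
               (λ h → transpose-⇨ (trans (x∧y≤y _ _) h))

module TriposFacts {c ℓ₁ ℓ₂ : Level} (𝒯 : Tripos c ℓ₁ ℓ₂) where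
  open Tripos 𝒯

  module _ {i} {Y : Set i} where
    open HeytingAlgebraFacts (P Y) public

  Pf-mono : ∀ {i j} {X : Set i} {Y : Set j} (f : X → Y) {φ ψ} →
            ≤[ P Y ] φ ψ → ≤[ P X ] (Pf f φ) (Pf f ψ)
  Pf-mono {X = X} {Y} f {φ} {ψ} φ≤ψ =
    X.≤-respˡ-≈ (Pf-cong f φ∧ψ≈φ) (X.≤-respˡ-≈ (X.Eq.sym (Pf-∧ f φ ψ)) (X.x∧y≤y _ _))
    where
    module X = HeytingAlgebra (P X)
    module Y = HeytingAlgebra (P Y)
    φ∧ψ≈φ : ≈[ P Y ] (∧[ P Y ] φ ψ) φ
    φ∧ψ≈φ = Y.antisym (Y.x∧y≤x _ _) (Y.∧-greatest Y.refl φ≤ψ)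

  Pf-∘-≗ : ∀ {i j k} {X' : Set i} {X : Set j} {Y : Set k}
           (r : X' → X) {f : X → Y} {g : X' → Y} → f ∘ r ≗ g →
           ∀ φ → ≈[ P X' ] (Pf r (Pf f φ)) (Pf g φ)
  Pf-∘-≗ {X' = X'} r {f} {g} f∘r≗g φ =
    HeytingAlgebra.Eq.trans (P X') (HeytingAlgebra.Eq.sym (P X') (Pf-∘ r f φ))
                                   (Pf-ext (f ∘ r) g f∘r≗g φ)

  Pf-≤-reindex : ∀ {i j k l} {X' : Set i} {X : Set j} {Y : Set k} {Z : Set l}
                 (r : X' → X) {f : X → Y} {f' : X' → Y} {g : X → Z} {g' : X' → Z} →
                 f ∘ r ≗ f' → g ∘ r ≗ g' → ∀ {φ ψ} →
                 ≤[ P X ] (Pf f φ) (Pf g ψ) → ≤[ P X' ] (Pf f' φ) (Pf g' ψ)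
  Pf-≤-reindex r f∘r≗f' g∘r≗g' {φ} {ψ} h =
    to (≤-resp-≈⇔ (Pf-∘-≗ r f∘r≗f' φ) (Pf-∘-≗ r g∘r≗g' ψ)) (Pf-mono r h)

module SettingFacts {c ℓ₁ ℓ₂ ℓ : Level} (𝒮 : Setting c ℓ₁ ℓ₂ ℓ) where
  open Setting 𝒮
  open TriposFacts tripos public

  Members : ∀ {i} {Y : Set i} → (Y → 𝔓Σ) → Set (i ⊔ ℓ)
  Members {Y = Y} s = Σ Y λ y → Σ Σ̇ λ ξ → ξ ∈̇ s y

  member : ∀ {i} {Y : Set i} {s : Y → 𝔓Σ} → Members s → Σ̇
  member (_ , ξ , _) = ξ

  asE : ∀ {i} {Y : Set i} {s : Y → 𝔓Σ} → Members s → E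
  asE {s = s} (y , ξ , ξ∈sy) = (ξ , s y) , ξ∈sy

  members-pullback : ∀ {i} {Y : Set i} (s : Y → 𝔓Σ) → IsPullback asE proj₁ e₂ s
  members-pullback s = record
    { commutes  = λ _ → refl
    ; universal = λ h k e₂∘h≗s∘k →
        (λ z → k z , e₁ (h z) , subst (e₁ (h z) ∈̇_) (e₂∘h≗s∘k z) (proj₂ (h z)))
        , (λ z → transport-E (h z) (e₂∘h≗s∘k z)) , (λ _ → refl)
    ; unique    = λ u v asE-eq proj₁-eq z →
        Members-≡ (u z) (v z) (proj₁-eq z) (cong e₁ (asE-eq z))
    }
    where
    transport-E : ∀ (w : E) {t} (p : e₂ w ≡ t) →
                  ((e₁ w , t) , subst (e₁ w ∈̇_) p (proj₂ w)) ≡ w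
    transport-E _ refl = refl
    Members-≡ : ∀ (z z' : Members s) → proj₁ z ≡ proj₁ z' → member z ≡ member z' → z ≡ z'
    Members-≡ (y , ξ , m) (.y , .ξ , m') refl refl = cong (λ m → y , ξ , m) (∈-prop m m')

  -- Beck–Chevalley for the pullback of e₂ along s turns ⟦ meet ∘ s ⟧Σ into the
  -- universal quantification of ⟦ member ⟧Σ along Members s → Y.
  ≤meet⇔ : ∀ {i} {Y : Set i} (s : Y → 𝔓Σ) ψ →
           ≤[ P Y ] ψ ⟦ meet ∘ s ⟧Σ ⇔ ≤[ P (Members s) ] (Pf proj₁ ψ) ⟦ member ⟧Σ
  ≤meet⇔ {Y = Y} s ψ = begin
    ≤[ P Y ] ψ ⟦ meet ∘ s ⟧Σ
      ∼⟨ ≤-resp-≈⇔ Y.Eq.refl meet∘s≈ ⟩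
    ≤[ P Y ] ψ (All proj₁ (Pf asE ⟦ e₁ ⟧Σ))
      ∼⟨ ⇔.sym (Pf⊣All proj₁ ψ _) ⟩
    ≤[ P (Members s) ] (Pf proj₁ ψ) (Pf asE ⟦ e₁ ⟧Σ)
      ∼⟨ ≤-resp-≈⇔ (HeytingAlgebra.Eq.refl (P (Members s))) (Pf-∘-≗ asE (λ _ → refl) trΣ) ⟩
    ≤[ P (Members s) ] (Pf proj₁ ψ) ⟦ member ⟧Σ ∎
    where
    open EquationalReasoning {k = equivalence}
    module Y = HeytingAlgebra (P Y)
    meet∘s≈ : ≈[ P Y ] ⟦ meet ∘ s ⟧Σ (All proj₁ (Pf asE ⟦ e₁ ⟧Σ))
    meet∘s≈ = Y.Eq.trans (Pf-∘ s meet trΣ)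
                (Y.Eq.trans (Pf-cong s meet-spec) (BC-All (members-pullback s) ⟦ e₁ ⟧Σ))

  meet-lowerBound : ∀ {i j} {Y : Set i} {Z : Set j} (s : Y → 𝔓Σ) (r : Z → Y) (u : Z → Σ̇) →
                    (∀ z → u z ∈̇ s (r z)) → ≤[ P Z ] (Pf r ⟦ meet ∘ s ⟧Σ) ⟦ u ⟧Σ
  meet-lowerBound {Y = Y} s r u u∈s∘r =
    Pf-≤-reindex (λ z → r z , u z , u∈s∘r z) (λ _ → refl) (λ _ → refl)
      (to (≤meet⇔ s ⟦ meet ∘ s ⟧Σ) (HeytingAlgebra.refl (P Y)))

  meet-antitone : ∀ {i} {Y : Set i} {s t : Y → 𝔓Σ} → (∀ y ξ → ξ ∈̇ s y → ξ ∈̇ t y) →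
                  ≤[ P Y ] ⟦ meet ∘ t ⟧Σ ⟦ meet ∘ s ⟧Σ
  meet-antitone {s = s} {t} s⊆t =
    from (≤meet⇔ s _) (meet-lowerBound t proj₁ member λ (y , ξ , ξ∈sy) → s⊆t y ξ ξ∈sy)

  record Enumeration {i} {Y : Set i} (s : Y → 𝔓Σ) (j : Level) : Set (i ⊔ ℓ ⊔ lsuc j) where
    field
      Index         : Set j
      owner         : Index → Y
      element       : Index → Σ̇
      element-∈     : ∀ k → element k ∈̇ s (owner k)
      index         : Members s → Index
      owner-index   : owner ∘ index ≗ proj₁
      element-index : element ∘ index ≗ member

  ≤meet⇔-enumeration : ∀ {i j} {Y : Set i} {s : Y → 𝔓Σ} (en : Enumeration s j) ψ →
    let open Enumeration en in
    ≤[ P Y ] ψ ⟦ meet ∘ s ⟧Σ ⇔ ≤[ P Index ] (Pf owner ψ) ⟦ element ⟧Σ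
  ≤meet⇔-enumeration {s = s} en ψ = ⇔.trans (≤meet⇔ s ψ) (mk⇔
    (Pf-≤-reindex (λ k → owner k , element k , element-∈ k) (λ _ → refl) (λ _ → refl))
    (Pf-≤-reindex index owner-index element-index))
    where open Enumeration en

  arrow-⇨ : ∀ {i} {Y : Set i} (u v : Y → Σ̇) →
            ≈[ P Y ] ⟦ (λ y → arrow (u y , v y)) ⟧Σ (⇨[ P Y ] ⟦ u ⟧Σ ⟦ v ⟧Σ)
  arrow-⇨ {Y = Y} u v = begin
    ⟦ arrow ∘ ⟨u,v⟩ ⟧Σ                          ≈⟨ Pf-∘ ⟨u,v⟩ arrow trΣ ⟩
    Pf ⟨u,v⟩ ⟦ arrow ⟧Σ                         ≈⟨ Pf-cong ⟨u,v⟩ arrow-spec ⟩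
    Pf ⟨u,v⟩ (⇨[ P (Σ̇ × Σ̇) ] ⟦ proj₁ ⟧Σ ⟦ proj₂ ⟧Σ) ≈⟨ Pf-⇨ ⟨u,v⟩ _ _ ⟩
    Pf ⟨u,v⟩ ⟦ proj₁ ⟧Σ ⇨ Pf ⟨u,v⟩ ⟦ proj₂ ⟧Σ     ≈⟨ ⇨-cong (Pf-∘-≗ ⟨u,v⟩ (λ _ → refl) trΣ)
                                                          (Pf-∘-≗ ⟨u,v⟩ (λ _ → refl) trΣ) ⟩
    ⟦ u ⟧Σ ⇨ ⟦ v ⟧Σ                             ∎
    where
    open HeytingAlgebra (P Y) using (_⇨_)
    open import Relation.Binary.Reasoning.Setoid (HeytingAlgebra.setoid (P Y))
    open import Relation.Binary.Lattice.Properties.HeytingAlgebra (P Y) using (⇨-cong)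
    ⟨u,v⟩ : Y → Σ̇ × Σ̇
    ⟨u,v⟩ y = u y , v y

module ConstructionFacts {c ℓ₁ ℓ₂ ℓ : Level} (𝒮 : Setting c ℓ₁ ℓ₂ ℓ) where
  open Construction 𝒮
  open SettingFacts 𝒮

  ∈φ̃₀⇔ : ∀ d ξ → (ξ ∈̇ φ̃₀ d) ⇔ (Σ 𝒜₀ λ α → mem d α × (φ₀ α ≡ ξ))
  ∈φ̃₀⇔ d = ｛｝-spec _

  φ₀-∈φ̃₀ : ∀ d {α} → mem d α → φ₀ α ∈̇ φ̃₀ d
  φ₀-∈φ̃₀ d {α} α∈d = from (∈φ̃₀⇔ d _) (α , α∈d , refl)

  φ̃₀-⊆ : ∀ d {s} → d φ̃₀⊆ s → ∀ ξ → ξ ∈̇ φ̃₀ d → ξ ∈̇ s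
  φ̃₀-⊆ d d⊆s ξ ξ∈φ̃₀d with to (∈φ̃₀⇔ d ξ) ξ∈φ̃₀d
  ... | α , α∈d , refl = d⊆s α α∈d

  ⟦⟧𝒜≈ : ∀ {i} {X : Set i} (a : X → 𝒜) → ≈[ P X ] ⟦ a ⟧𝒜 ⟦ φ ∘ a ⟧Σ
  ⟦⟧𝒜≈ {X = X} a = HeytingAlgebra.Eq.sym (P X) (Pf-∘ a φ trΣ)

  Atoms : ∀ {i} {Y : Set i} → (Y → 𝒜) → Set (i ⊔ ℓ)
  Atoms {Y = Y} d = Σ Y λ y → Σ 𝒜₀ (mem (d y))

  atomEnumeration : ∀ {i} {Y : Set i} (d : Y → 𝒜) → Enumeration (φ̃₀ ∘ d) (i ⊔ ℓ)
  atomEnumeration d = record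
    { Index         = Atoms d
    ; owner         = proj₁
    ; element       = φ₀ ∘ proj₁ ∘ proj₂
    ; element-∈     = λ (y , _ , α∈dy) → φ₀-∈φ̃₀ (d y) α∈dy
    ; index         = λ (y , ξ , ξ∈) → let α , α∈dy , _ = to (∈φ̃₀⇔ (d y) ξ) ξ∈ in y , α , α∈dy
    ; owner-index   = λ _ → refl
    ; element-index = λ (y , ξ , ξ∈) → proj₂ (proj₂ (to (∈φ̃₀⇔ (d y) ξ) ξ∈))
    }

  ArrowAtoms : 𝒜 → Set ℓ
  ArrowAtoms d = Σ 𝔓Σ λ s → Σ 𝒜₀ λ β → mem d (s ↦ β)

  arrowAtomEnumeration : ∀ d → (∀ ξ → ¬ mem d (dot ξ)) →
                         Enumeration (λ (_ : 𝟙) → φ̃₀ d) ℓ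
  arrowAtomEnumeration d no-dot = record
    { Index         = ArrowAtoms d
    ; owner         = λ _ → tt
    ; element       = λ (s , β , _) → φ₀ (s ↦ β)
    ; element-∈     = λ (_ , _ , α∈d) → φ₀-∈φ̃₀ d α∈d
    ; index         = λ (_ , ξ , ξ∈) → proj₁ (asArrowAtom (to (∈φ̃₀⇔ d ξ) ξ∈))
    ; owner-index   = λ _ → refl
    ; element-index = λ (_ , ξ , ξ∈) → proj₂ (asArrowAtom (to (∈φ̃₀⇔ d ξ) ξ∈))
    }
    where
    asArrowAtom : ∀ {ξ} → Σ 𝒜₀ (λ α → mem d α × (φ₀ α ≡ ξ)) →
                  Σ (ArrowAtoms d) λ k → φ₀ (proj₁ k ↦ proj₁ (proj₂ k)) ≡ ξ
    asArrowAtom (dot ξ  , ξ∈d   , _)   = ⊥-elim (no-dot ξ ξ∈d)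
    asArrowAtom (s ↦ β , s↦β∈d , eq) = (s , β , s↦β∈d) , eq

  ⋀⇒-no-dot : ∀ {X : Set ℓ} (a b : X → 𝒜) ξ → ¬ mem (⋀ λ x → a x ⇒ b x) (dot ξ)
  ⋀⇒-no-dot a b ξ (_ , lift ())

  ≤⇔atomwise : ∀ {i} {X : Set i} (a b : X → 𝒜) →
               ≤[ P X ] ⟦ a ⟧𝒜 ⟦ b ⟧𝒜 ⇔
               ≤[ P (Atoms b) ] ⟦ φ ∘ a ∘ proj₁ ⟧Σ ⟦ φ₀ ∘ proj₁ ∘ proj₂ ⟧Σ
  ≤⇔atomwise {X = X} a b = begin
    ≤[ P X ] ⟦ a ⟧𝒜 ⟦ b ⟧𝒜
      ∼⟨ ≤-resp-≈⇔ (⟦⟧𝒜≈ a) (⟦⟧𝒜≈ b) ⟩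
    ≤[ P X ] ⟦ φ ∘ a ⟧Σ ⟦ meet ∘ φ̃₀ ∘ b ⟧Σ
      ∼⟨ ≤meet⇔-enumeration (atomEnumeration b) _ ⟩
    ≤[ P (Atoms b) ] (Pf proj₁ ⟦ φ ∘ a ⟧Σ) ⟦ φ₀ ∘ proj₁ ∘ proj₂ ⟧Σ
      ∼⟨ ≤-resp-≈⇔ (Pf-∘-≗ proj₁ (λ _ → refl) trΣ) (HeytingAlgebra.Eq.refl (P (Atoms b))) ⟩
    ≤[ P (Atoms b) ] ⟦ φ ∘ a ∘ proj₁ ⟧Σ ⟦ φ₀ ∘ proj₁ ∘ proj₂ ⟧Σ ∎
    where open EquationalReasoning {k = equivalence}

  ∈S⇔arrowAtomwise : ∀ d → (∀ ξ → ¬ mem d (dot ξ)) →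
                     d ∈S ⇔ ≤[ P (ArrowAtoms d) ] ⟦ meet ∘ proj₁ ⟧Σ ⟦ φ₀ ∘ proj₁ ∘ proj₂ ⟧Σ
  ∈S⇔arrowAtomwise d no-dot = begin
    (d ∈S)
      ∼⟨ ≈⊤⇔⊤≤ ⟩
    ≤[ P 𝟙 ] ⊤[ P 𝟙 ] ⟦ (λ _ → d) ⟧𝒜
      ∼⟨ ≤-resp-≈⇔ (HeytingAlgebra.Eq.refl (P 𝟙)) (⟦⟧𝒜≈ _) ⟩
    ≤[ P 𝟙 ] ⊤[ P 𝟙 ] ⟦ (λ _ → φ d) ⟧Σ
      ∼⟨ ≤meet⇔-enumeration (arrowAtomEnumeration d no-dot) _ ⟩
    ≤[ P A ] (Pf (λ _ → tt) ⊤[ P 𝟙 ]) ⟦ (λ (s , β , _) → φ₀ (s ↦ β)) ⟧Σ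
      ∼⟨ ≤-resp-≈⇔ (Pf-⊤ _) (arrow-⇨ (meet ∘ proj₁) (φ₀ ∘ proj₁ ∘ proj₂)) ⟩
    ≤[ P A ] ⊤[ P A ] (⇨[ P A ] ⟦ meet ∘ proj₁ ⟧Σ ⟦ φ₀ ∘ proj₁ ∘ proj₂ ⟧Σ)
      ∼⟨ ⊤≤⇨⇔≤ ⟩
    ≤[ P A ] ⟦ meet ∘ proj₁ ⟧Σ ⟦ φ₀ ∘ proj₁ ∘ proj₂ ⟧Σ ∎
    where
    open EquationalReasoning {k = equivalence}
    A = ArrowAtoms d

  atomwise⇔arrowAtomwise : ∀ {X : Set ℓ} (a b : X → 𝒜) →
    let A = ArrowAtoms (⋀ λ x → a x ⇒ b x) in
    ≤[ P (Atoms b) ] ⟦ φ ∘ a ∘ proj₁ ⟧Σ ⟦ φ₀ ∘ proj₁ ∘ proj₂ ⟧Σ ⇔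
    ≤[ P A ] ⟦ meet ∘ proj₁ ⟧Σ ⟦ φ₀ ∘ proj₁ ∘ proj₂ ⟧Σ
  atomwise⇔arrowAtomwise a b = mk⇔
    (λ h → HeytingAlgebra.trans (P A)
             (meet-antitone (λ (_ , _ , x , ax⊆s , _) → φ̃₀-⊆ (a x) ax⊆s))
             (Pf-≤-reindex toAtom (λ _ → refl) (λ _ → refl) h))
    (Pf-≤-reindex toArrowAtom (λ _ → refl) (λ _ → refl))
    where
    A = ArrowAtoms (⋀ λ x → a x ⇒ b x)
    toAtom : A → Atoms b
    toAtom (_ , β , x , _ , β∈bx) = x , β , β∈bx
    toArrowAtom : Atoms b → A
    toArrowAtom (x , β , β∈bx) = φ̃₀ (a x) , β , x , (λ _ → φ₀-∈φ̃₀ (a x)) , β∈bx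

proposition3p14 : ∀ {c ℓ₁ ℓ₂ ℓ : Level} (𝒮 : Setting c ℓ₁ ℓ₂ ℓ) →
    let open Construction 𝒮 in
    ∀ (X : Set ℓ) (a b : X → 𝒜) →
      ≤[ P X ] ⟦ a ⟧𝒜 ⟦ b ⟧𝒜 ⇔ (⋀ (λ x → a x ⇒ b x) ∈S)
proposition3p14 𝒮 X a b =
  ⇔.trans (≤⇔atomwise a b)
    (⇔.trans (atomwise⇔arrowAtomwise a b)
      (⇔.sym (∈S⇔arrowAtomwise _ (⋀⇒-no-dot a b))))
  where open ConstructionFacts 𝒮
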